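{- Let $G=(V,E)$ be a connected graph on vertices $u_1,\dots,u_n$ with distance matrix $D$. Assume there exists $\vec x\in\mathbb{R}^n$ such that $\vec 1^\top\vec x=1$ and $D\vec x=r\vec 1$ for some $r\in\mathbb{R}$. Let $u^\ast\in V$ be a fixed vertex, and let $\widetilde G$ be the graph obtained by adding a single new vertex $u_{n+1}$ and the edge $\{u^\ast,u_{n+1}\}$. Define $\vec x'\in\mathbb{R}^{n+1}$ by $\vec x'_i=\vec x_i-\tfrac12$ if $u_i=u^\ast$, $\vec x'_{n+1}=\tfrac12$, and $\vec x'_i=\vec x_i$ otherwise ($1\le i\le n$). Let $D'$ denote the distance matrix of $\widetilde G$. Then (i) $\vec 1^\top\vec x'=1$, and (ii) $D'\vec x'=(r+\tfrac12)\vec 1$.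
   Context: For a connected graph with vertices $v_1,\dots,v_n$, the distance matrix is $D=(d(v_i,v_j))_{i,j}$ where $d$ is the shortest-path distance; $\vec 1$ denotes the all-ones vector of the appropriate dimension. -}

module Defs where

open import Level using (Level)
open import Data.Nat using (ℕ; zero; suc; _≤_)
open import Data.Fin using (Fin; zero; suc; _≟_)
open import Data.Maybe using (Maybe; just; nothing)
import Data.Maybe as Maybe
open import Data.Product using (_×_; ∃)
open import Data.Empty using (⊥)
open import Relation.Nullary using (yes; no)
open import Relation.Binary.PropositionalEquality using (_≡_)
open import Algebra.Bundles using (CommutativeRing)

-- A (simple, undirected) graph on the vertex set Fin n is given by an
-- adjacency relation; symmetry / irreflexivity are imposed as hypotheses.

data Walk {n : ℕ} (Adj : Fin n → Fin n → Set) : Fin n → Fin n → ℕ → Set where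
  here : ∀ {u} → Walk Adj u u zero
  step : ∀ {u w v k} → Adj u w → Walk Adj w v k → Walk Adj u v (suc k)

IsSymmetric : {n : ℕ} → (Fin n → Fin n → Set) → Set
IsSymmetric Adj = ∀ u v → Adj u v → Adj v u

IsIrreflexive : {n : ℕ} → (Fin n → Fin n → Set) → Set
IsIrreflexive Adj = ∀ u → Adj u u → ⊥

Connected : {n : ℕ} → (Fin n → Fin n → Set) → Set
Connected Adj = ∀ u v → ∃ λ k → Walk Adj u v k

IsDist : {n : ℕ} → (Fin n → Fin n → Set) → Fin n → Fin n → ℕ → Set
IsDist Adj u v k = Walk Adj u v k × (∀ m → Walk Adj u v m → k ≤ m)

IsDistanceMatrix : {n : ℕ} → (Fin n → Fin n → Set) → (Fin n → Fin n → ℕ) → Set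
IsDistanceMatrix Adj D = ∀ u v → IsDist Adj u v (D u v)

-- Vertices of Fin (suc n): the old vertices 0..n-1 (just i) and the new
-- last vertex n (nothing).
toOld : {n : ℕ} → Fin (suc n) → Maybe (Fin n)
toOld {zero} zero = nothing
toOld {suc n} zero = just zero
toOld {suc n} (suc i) = Maybe.map suc (toOld i)

addPendant : {n : ℕ} → (Fin n → Fin n → Set) → Fin n → Fin (suc n) → Fin (suc n) → Set
addPendant Adj ustar i j with toOld i | toOld j
... | just a  | just b  = Adj a b
... | just a  | nothing = a ≡ ustar
... | nothing | just b  = b ≡ ustar
... | nothing | nothing = ⊥

module _ {c ℓ : Level} (R : CommutativeRing c ℓ) where
  open CommutativeRing R using (Carrier; 0#; 1#; _+_; _*_; _-_)

  sumF : {n : ℕ} → (Fin n → Carrier) → Carrier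
  sumF {zero} f = 0#
  sumF {suc n} f = f zero + sumF (λ i → f (suc i))

  ofℕ : ℕ → Carrier
  ofℕ zero = 0#
  ofℕ (suc k) = 1# + ofℕ k

  mulVec : {n : ℕ} → (Fin n → Fin n → ℕ) → (Fin n → Carrier) → Fin n → Carrier
  mulVec M x i = sumF (λ j → ofℕ (M i j) * x j)

  -- the vector x' of the lemma; half is the element 1/2
  extendVec : {n : ℕ} → Carrier → Fin n → (Fin n → Carrier) → Fin (suc n) → Carrier
  extendVec half ustar x i with toOld i
  ... | nothing = half
  ... | just a with a ≟ ustar
  ...   | yes _ = x a - half
  ...   | no _  = x a

-- Contracting the pendant edge onto u* sends every edge of the extended graph to an
-- edge of G or to a loop, so distances between old vertices are unchanged and the
-- pendant vertex lies at distance d(v, u*) + 1 from every old vertex v.  Moving the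
-- weight 1/2 from u* to the pendant vertex therefore turns row v of D x into
-- (D x)_v − d(v, u*)/2 + (d(v, u*) + 1)/2 = r + 1/2, while the row of the pendant
-- vertex is Σ x − 1/2 + (D x)_{u*} − d(u*, u*)/2 = 1 − 1/2 + r.
module Submission where

open import Defs
open import Level using (Level)
open import Data.Nat using (ℕ; zero; suc; _≤_; z≤n; s≤s)
open import Data.Nat.Properties using (≤-antisym; ≤-trans; m≤n⇒m≤1+n)
open import Data.Fin using (Fin; zero; suc; inject₁; fromℕ; punchIn; _≟_)
open import Data.Fin.Properties using (fromℕ≢inject₁; punchInᵢ≢i)
open import Data.Vec.Functional using (Vector; init; last)
open import Data.Maybe using (just; nothing; fromMaybe)
open import Data.Product using (∃; _×_; _,_)
open import Data.Sum using (_⊎_; inj₁; inj₂)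
open import Data.Empty using (⊥-elim)
open import Function using (_∘_)
open import Relation.Nullary using (yes; no)
open import Relation.Binary.PropositionalEquality as ≡ using (_≡_; _≢_; refl; subst; cong; cong₂)
open import Algebra.Bundles using (CommutativeRing)

toOld-inject₁ : ∀ {n} (a : Fin n) → toOld (inject₁ a) ≡ just a
toOld-inject₁ {suc _} zero    = refl
toOld-inject₁ {suc _} (suc a) rewrite toOld-inject₁ a = refl

toOld-fromℕ : ∀ n → toOld (fromℕ n) ≡ nothing
toOld-fromℕ zero    = refl
toOld-fromℕ (suc n) rewrite toOld-fromℕ n = refl

data OldOrNew {n : ℕ} : Fin (suc n) → Set where
  old : (a : Fin n) → OldOrNew (inject₁ a)
  new : OldOrNew (fromℕ n)

oldOrNew : ∀ {n} (i : Fin (suc n)) → OldOrNew i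
oldOrNew {zero}  zero    = new
oldOrNew {suc n} zero    = old zero
oldOrNew {suc n} (suc i) with oldOrNew i
... | old a = old (suc a)
... | new   = new

module _ {n : ℕ} {A : Fin n → Fin n → Set} where

  walk-zero : ∀ {i j} → Walk A i j zero → i ≡ j
  walk-zero here = refl

  unsnoc : ∀ {i j m} → Walk A i j (suc m) → ∃ λ w → Walk A i w m × A w j
  unsnoc (step e here)             = _ , here , e
  unsnoc (step e (step e′ rest)) with unsnoc (step e′ rest)
  ... | w , walk , e″ = w , step e walk , e″

  snoc : ∀ {i j k m} → Walk A i j m → A j k → Walk A i k (suc m)
  snoc here         e = step e here
  snoc (step e′ w) e = step e′ (snoc w e)

  IsDist-functional : ∀ {i j d e} → IsDist A i j d → IsDist A i j e → d ≡ e
  IsDist-functional (wd , min-d) (we , min-e) = ≤-antisym (min-d _ we) (min-e _ wd)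

  IsDist-refl : ∀ i → IsDist A i i zero
  IsDist-refl i = here , λ _ _ → z≤n

module Pendant {n : ℕ} (Adj : Fin n → Fin n → Set) (u : Fin n) where

  private
    Adj′ : Fin (suc n) → Fin (suc n) → Set
    Adj′ = addPendant Adj u

  contract : Fin (suc n) → Fin n
  contract i = fromMaybe u (toOld i)

  contract-inject₁ : ∀ a → contract (inject₁ a) ≡ a
  contract-inject₁ a rewrite toOld-inject₁ a = refl

  lift-edge : ∀ {a b} → Adj a b → Adj′ (inject₁ a) (inject₁ b)
  lift-edge {a} {b} e rewrite toOld-inject₁ a | toOld-inject₁ b = e

  edge-to-new : Adj′ (inject₁ u) (fromℕ n)
  edge-to-new rewrite toOld-inject₁ u | toOld-fromℕ n = refl

  edge-from-new : Adj′ (fromℕ n) (inject₁ u)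
  edge-from-new rewrite toOld-inject₁ u | toOld-fromℕ n = refl

  contract-edge : ∀ {i j} → Adj′ i j → Adj (contract i) (contract j) ⊎ contract i ≡ contract j
  contract-edge {i} {j} e with toOld i | toOld j
  ... | just a  | just b  = inj₁ e
  ... | just a  | nothing = inj₂ e
  ... | nothing | just b  = inj₂ (≡.sym e)

  contract-edge-into : ∀ {i j} → toOld j ≡ nothing → Adj′ i j → contract i ≡ u
  contract-edge-into {i} {j} j-new e with toOld i | toOld j
  ... | just a  | nothing = e
  ... | nothing | nothing = refl

  contract-edge-out : ∀ {i j} → toOld i ≡ nothing → Adj′ i j → contract j ≡ u
  contract-edge-out {i} {j} i-new e with toOld i | toOld j
  ... | nothing | just b  = e
  ... | nothing | nothing = refl

  lift : ∀ {a b k} → Walk Adj a b k → Walk Adj′ (inject₁ a) (inject₁ b) k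
  lift here       = here
  lift (step e w) = step (lift-edge e) (lift w)

  contract-walk : ∀ {i j s t m} → contract i ≡ s → contract j ≡ t →
                  Walk Adj′ i j m → ∃ λ k → Walk Adj s t k × k ≤ m
  contract-walk refl refl here = zero , here , z≤n
  contract-walk refl refl (step e w) with contract-walk refl refl w | contract-edge e
  ... | k , w′ , k≤m | inj₁ e′ = suc k , step e′ w′ , s≤s k≤m
  ... | k , w′ , k≤m | inj₂ eq = k , subst (λ s → Walk Adj s _ k) (≡.sym eq) w′ , m≤n⇒m≤1+n k≤m

  walk-old : ∀ {a b m} → Walk Adj′ (inject₁ a) (inject₁ b) m → ∃ λ k → Walk Adj a b k × k ≤ m
  walk-old = contract-walk (contract-inject₁ _) (contract-inject₁ _)

  walk-into-new : ∀ {a m} → Walk Adj′ (inject₁ a) (fromℕ n) m → ∃ λ k → Walk Adj a u k × suc k ≤ m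
  walk-into-new {m = zero}  w = ⊥-elim (fromℕ≢inject₁ (≡.sym (walk-zero w)))
  walk-into-new {m = suc m} w with unsnoc w
  ... | _ , w′ , e with contract-walk (contract-inject₁ _) (contract-edge-into (toOld-fromℕ n) e) w′
  ...   | k , w″ , k≤m = k , w″ , s≤s k≤m

  walk-out-of-new : ∀ {b m} → Walk Adj′ (fromℕ n) (inject₁ b) m → ∃ λ k → Walk Adj u b k × suc k ≤ m
  walk-out-of-new {m = zero}  w          = ⊥-elim (fromℕ≢inject₁ (walk-zero w))
  walk-out-of-new {m = suc m} (step e w) with contract-walk (contract-edge-out (toOld-fromℕ n) e) (contract-inject₁ _) w
  ... | k , w′ , k≤m = k , w′ , s≤s k≤m

  isDist-old : ∀ {a b d} → IsDist Adj a b d → IsDist Adj′ (inject₁ a) (inject₁ b) d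
  isDist-old (w , shortest) =
    lift w , λ _ w′ → let k , w″ , k≤m = walk-old w′ in ≤-trans (shortest k w″) k≤m

  isDist-into-new : ∀ {a d} → IsDist Adj a u d → IsDist Adj′ (inject₁ a) (fromℕ n) (suc d)
  isDist-into-new (w , shortest) =
    snoc (lift w) edge-to-new , λ _ w′ → let k , w″ , k<m = walk-into-new w′ in ≤-trans (s≤s (shortest k w″)) k<m

  isDist-out-of-new : ∀ {b d} → IsDist Adj u b d → IsDist Adj′ (fromℕ n) (inject₁ b) (suc d)
  isDist-out-of-new (w , shortest) =
    step edge-from-new (lift w) , λ _ w′ → let k , w″ , k<m = walk-out-of-new w′ in ≤-trans (s≤s (shortest k w″)) k<m

record PendantDistances {n : ℕ} (u : Fin n) (D : Fin n → Fin n → ℕ)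
                        (D′ : Fin (suc n) → Fin (suc n) → ℕ) : Set where
  field
    old-old : ∀ a b → D′ (inject₁ a) (inject₁ b) ≡ D a b
    old-new : ∀ a → D′ (inject₁ a) (fromℕ n) ≡ suc (D a u)
    new-old : ∀ b → D′ (fromℕ n) (inject₁ b) ≡ suc (D u b)
    new-new : D′ (fromℕ n) (fromℕ n) ≡ zero

IsDistanceMatrix-diagonal : ∀ {n A D} → IsDistanceMatrix {n} A D → ∀ i → D i i ≡ zero
IsDistanceMatrix-diagonal isD i = IsDist-functional (isD i i) (IsDist-refl i)

pendantDistances : ∀ {n Adj D D′} (u : Fin n) → IsDistanceMatrix Adj D →
                   IsDistanceMatrix (addPendant Adj u) D′ → PendantDistances u D D′
pendantDistances {n} {Adj} u isD isD′ = record
  { old-old = λ a b → IsDist-functional (isD′ _ _) (isDist-old (isD a b))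
  ; old-new = λ a → IsDist-functional (isD′ _ _) (isDist-into-new (isD a u))
  ; new-old = λ b → IsDist-functional (isD′ _ _) (isDist-out-of-new (isD u b))
  ; new-new = IsDistanceMatrix-diagonal isD′ (fromℕ n)
  }
  where open Pendant Adj u

module _ {c ℓ : Level} (R : CommutativeRing c ℓ) where
  open CommutativeRing R hiding (zero; refl)
  open import Algebra.Properties.Semiring.Sum semiring using (sum; sum-cong-≋; sum-cong-≗; sum-init-last; sum-remove; ∑-distrib-+)
  open import Algebra.Properties.AbelianGroup +-abelianGroup using (//-rightDividesˡ; //-rightDividesʳ; ε⁻¹≈ε)
  open import Algebra.Properties.Ring ring using (x[y-z]≈xy-xz)
  open import Algebra.Properties.CommutativeSemigroup +-commutativeSemigroup using (xy∙z≈xz∙y)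
  open import Relation.Binary.Reasoning.Setoid setoid

  sumF≡sum : ∀ {n} (f : Vector Carrier n) → sumF R f ≡ sum f
  sumF≡sum {zero}  f = ≡.refl
  sumF≡sum {suc n} f = cong (f zero +_) (sumF≡sum (f ∘ suc))

  mulVec≡sum : ∀ {n} (M : Fin n → Fin n → ℕ) (y : Vector Carrier n) i →
               mulVec R M y i ≡ sum (λ j → ofℕ R (M i j) * y j)
  mulVec≡sum M y i = sumF≡sum (λ j → ofℕ R (M i j) * y j)

  sum-perturb : ∀ {n} (u : Fin n) {f g : Vector Carrier n} {h : Carrier} →
                f u ≈ g u - h → (∀ j → j ≢ u → f j ≈ g j) → sum f ≈ sum g - h
  sum-perturb {suc n} u {f} {g} {h} fu≈gu-h f≈g = begin
    sum f                                     ≈⟨ sum-remove {i = u} f ⟩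
    f u + sum (f ∘ punchIn u)                 ≈⟨ +-cong fu≈gu-h (sum-cong-≋ (λ j → f≈g _ (punchInᵢ≢i u j))) ⟩
    (g u - h) + sum (g ∘ punchIn u)           ≈⟨ xy∙z≈xz∙y (g u) (- h) _ ⟩
    (g u + sum (g ∘ punchIn u)) - h           ≈⟨ +-congʳ (sum-remove {i = u} g) ⟨
    sum g - h                                 ∎

  x+x≈1⇒1-x≈x : ∀ {x} → x + x ≈ 1# → 1# - x ≈ x
  x+x≈1⇒1-x≈x {x} x+x≈1 = trans (+-congʳ (sym x+x≈1)) (//-rightDividesʳ x x)

  ofℕ-suc-* : ∀ k y → ofℕ R (suc k) * y ≈ y + ofℕ R k * y
  ofℕ-suc-* k y = trans (distribʳ y 1# (ofℕ R k)) (+-congʳ (*-identityˡ y))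

  module _ (half : Carrier) {n : ℕ} (u : Fin n) (x : Vector Carrier n) where
    private
      x′ : Vector Carrier (suc n)
      x′ = extendVec R half u x

    extendVec-last : last x′ ≡ half
    extendVec-last rewrite toOld-fromℕ n = ≡.refl

    extendVec-ustar : init x′ u ≡ x u - half
    extendVec-ustar rewrite toOld-inject₁ u with u ≟ u
    ... | yes _   = ≡.refl
    ... | no u≢u = ⊥-elim (u≢u ≡.refl)

    extendVec-other : ∀ j → j ≢ u → init x′ j ≡ x j
    extendVec-other j j≢u rewrite toOld-inject₁ j with j ≟ u
    ... | yes j≡u = ⊥-elim (j≢u j≡u)
    ... | no _    = ≡.refl

    sum-init-extendVec : sum (init x′) ≈ sum x - half
    sum-init-extendVec = sum-perturb u (reflexive extendVec-ustar) (λ j j≢u → reflexive (extendVec-other j j≢u))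

    weighted-sum-init-extendVec : ∀ (w : Vector Carrier n) →
      sum (λ j → w j * init x′ j) ≈ sum (λ j → w j * x j) - w u * half
    weighted-sum-init-extendVec w = sum-perturb u
      (trans (*-congˡ (reflexive extendVec-ustar)) (x[y-z]≈xy-xz (w u) (x u) half))
      (λ j j≢u → *-congˡ (reflexive (extendVec-other j j≢u)))

    mulVec-extendVec : ∀ (M : Fin (suc n) → Fin (suc n) → ℕ) i →
      mulVec R M x′ i ≈ sum (λ j → ofℕ R (M i (inject₁ j)) * init x′ j) + ofℕ R (M i (fromℕ n)) * half
    mulVec-extendVec M i = begin
      mulVec R M x′ i                          ≡⟨ mulVec≡sum M x′ i ⟩
      sum (λ j → ofℕ R (M i j) * x′ j)        ≈⟨ sum-init-last (λ j → ofℕ R (M i j) * x′ j) ⟩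
      old-part + ofℕ R (M i (fromℕ n)) * last x′ ≡⟨ cong (λ y → old-part + ofℕ R (M i (fromℕ n)) * y) extendVec-last ⟩
      old-part + ofℕ R (M i (fromℕ n)) * half  ∎
      where
      old-part : Carrier
      old-part = sum (λ j → ofℕ R (M i (inject₁ j)) * init x′ j)

    module _ {D : Fin n → Fin n → ℕ} {D′ : Fin (suc n) → Fin (suc n) → ℕ} (pd : PendantDistances u D D′) where
      open PendantDistances pd

      mulVec-extendVec-old : ∀ a → mulVec R D′ x′ (inject₁ a) ≈ mulVec R D x a + half
      mulVec-extendVec-old a = begin
        mulVec R D′ x′ (inject₁ a)                                 ≈⟨ mulVec-extendVec D′ (inject₁ a) ⟩
        sum (λ j → ofℕ R (D′ (inject₁ a) (inject₁ j)) * init x′ j) + ofℕ R (D′ (inject₁ a) (fromℕ n)) * half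
          ≡⟨ cong₂ (λ s d → s + ofℕ R d * half) (sum-cong-≗ (λ j → cong (λ d → ofℕ R d * init x′ j) (old-old a j))) (old-new a) ⟩
        sum (λ j → ofℕ R (D a j) * init x′ j) + ofℕ R (suc (D a u)) * half
          ≈⟨ +-cong (weighted-sum-init-extendVec (λ j → ofℕ R (D a j))) (ofℕ-suc-* (D a u) half) ⟩
        (Dxa - t) + (half + t)                                     ≈⟨ +-congˡ (+-comm half t) ⟩
        (Dxa - t) + (t + half)                                     ≈⟨ +-assoc (Dxa - t) t half ⟨
        ((Dxa - t) + t) + half                                     ≈⟨ +-congʳ (//-rightDividesˡ t Dxa) ⟩
        Dxa + half                                                 ≡⟨ cong (_+ half) (mulVec≡sum D x a) ⟨
        mulVec R D x a + half                                      ∎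
        where
        Dxa t : Carrier
        Dxa = sum (λ j → ofℕ R (D a j) * x j)
        t   = ofℕ R (D a u) * half

      mulVec-extendVec-new : D u u ≡ zero → mulVec R D′ x′ (fromℕ n) ≈ (sumF R x - half) + mulVec R D x u
      mulVec-extendVec-new Duu≡0 = begin
        mulVec R D′ x′ (fromℕ n)                                   ≈⟨ mulVec-extendVec D′ (fromℕ n) ⟩
        sum (λ j → ofℕ R (D′ (fromℕ n) (inject₁ j)) * init x′ j) + ofℕ R (D′ (fromℕ n) (fromℕ n)) * half
          ≡⟨ cong₂ (λ s d → s + ofℕ R d * half) (sum-cong-≗ (λ j → cong (λ d → ofℕ R d * init x′ j) (new-old j))) new-new ⟩
        sum (λ j → ofℕ R (suc (D u j)) * init x′ j) + 0# * half
          ≈⟨ +-cong (sum-cong-≋ (λ j → ofℕ-suc-* (D u j) (init x′ j))) (zeroˡ half) ⟩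
        sum (λ j → init x′ j + ofℕ R (D u j) * init x′ j) + 0#     ≈⟨ +-identityʳ _ ⟩
        sum (λ j → init x′ j + ofℕ R (D u j) * init x′ j)          ≈⟨ ∑-distrib-+ (init x′) (λ j → ofℕ R (D u j) * init x′ j) ⟩
        sum (init x′) + sum (λ j → ofℕ R (D u j) * init x′ j)
          ≈⟨ +-cong sum-init-extendVec (weighted-sum-init-extendVec (λ j → ofℕ R (D u j))) ⟩
        (sum x - half) + (Dxu - ofℕ R (D u u) * half)             ≡⟨ cong (λ d → (sum x - half) + (Dxu - ofℕ R d * half)) Duu≡0 ⟩
        (sum x - half) + (Dxu - 0# * half)                          ≈⟨ +-congˡ (+-congˡ (trans (-‿cong (zeroˡ half)) ε⁻¹≈ε)) ⟩
        (sum x - half) + (Dxu + 0#)                                 ≈⟨ +-congˡ (+-identityʳ Dxu) ⟩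
        (sum x - half) + Dxu                                        ≡⟨ cong₂ (λ s t → (s - half) + t) (sumF≡sum x) (mulVec≡sum D x u) ⟨
        (sumF R x - half) + mulVec R D x u                          ∎
        where
        Dxu : Carrier
        Dxu = sum (λ j → ofℕ R (D u j) * x j)

    sumF-extendVec : sumF R x′ ≈ sumF R x
    sumF-extendVec = begin
      sumF R x′               ≡⟨ sumF≡sum x′ ⟩
      sum x′                  ≈⟨ sum-init-last x′ ⟩
      sum (init x′) + last x′ ≈⟨ +-cong sum-init-extendVec (reflexive extendVec-last) ⟩
      (sum x - half) + half   ≈⟨ //-rightDividesˡ half (sum x) ⟩
      sum x                   ≡⟨ sumF≡sum x ⟨
      sumF R x                ∎

lemma2p3 : {c ℓ : Level} (R : CommutativeRing c ℓ) →
    let open CommutativeRing R in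
    (half : Carrier) → half + half ≈ 1# →
    (n : ℕ) (Adj : Fin n → Fin n → Set) →
    IsSymmetric Adj → IsIrreflexive Adj → Connected Adj →
    (D : Fin n → Fin n → ℕ) → IsDistanceMatrix Adj D →
    (x : Fin n → Carrier) (r : Carrier) →
    sumF R x ≈ 1# → (∀ i → mulVec R D x i ≈ r) →
    (ustar : Fin n) →
    (D' : Fin (suc n) → Fin (suc n) → ℕ) → IsDistanceMatrix (addPendant Adj ustar) D' →
    (sumF R (extendVec R half ustar x) ≈ 1#)
      × (∀ i → mulVec R D' (extendVec R half ustar x) i ≈ r + half)
lemma2p3 R half half+half≈1 n Adj _ _ _ D isD x r Σx≈1 Dx≈r u D′ isD′ =
  trans (sumF-extendVec R half u x) Σx≈1 , row
  where
  open CommutativeRing R hiding (refl)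
  open import Relation.Binary.Reasoning.Setoid setoid

  pd : PendantDistances u D D′
  pd = pendantDistances u isD isD′

  row : ∀ i → mulVec R D′ (extendVec R half u x) i ≈ r + half
  row i with oldOrNew i
  ... | old a = trans (mulVec-extendVec-old R half u x pd a) (+-congʳ (Dx≈r a))
  ... | new   = begin
    mulVec R D′ (extendVec R half u x) (fromℕ n)
      ≈⟨ mulVec-extendVec-new R half u x pd (IsDistanceMatrix-diagonal isD u) ⟩
    (sumF R x - half) + mulVec R D x u  ≈⟨ +-cong (+-congʳ Σx≈1) (Dx≈r u) ⟩
    (1# - half) + r                     ≈⟨ +-congʳ (x+x≈1⇒1-x≈x R half+half≈1) ⟩
    half + r                            ≈⟨ +-comm half r ⟩
    r + half                            ∎
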